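{- Let $k\ge 4$ be an even integer and let $G$ be a $2$-regular $k$-uniform hypergraph with $n$ vertices and $m$ edges, where $m$ is odd. Then $G$ is minimal non-odd-bipartite if and only if $G$ is connected and $G$ is isomorphic to a hypergraph obtained by the following construction (with these $k,m$ and $n=km/2$). Construction: for $t\in[m]$ let $V_t=\{\tfrac{k}{2}(t-1)+1,\dots,\tfrac{k}{2}t\}\subseteq[n]$. Let $K_{n,n}$ be the complete bipartite graph with parts $U_1=[n]$ and $U_2=\bigcup_{t=1}^m E_t$, where $E_t=\{e_t^1,\dots,e_t^{k/2}\}$ are pairwise disjoint sets of new symbols, and let $\hat K_{n,n}$ be obtained by deleting all edges between $V_t$ and $E_t$ for every $t\in[m]$. Choose a perfect matching $\hat M$ of $\hat K_{n,n}$, and let $W_t\subseteq[n]$ be the set of vertices matched to $E_t$ in $\hat M$, with the requirement that whenever $W_t=V_s$ for some $s\neq t$, one has $W_s\neq V_t$. The hypergraph has vertex set $[n]$ and edges $e_t=V_t\cup W_t$, $t\in[m]$.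
   Context: A hypergraph $G=(V,E)$ has a finite vertex set and an edge set of distinct nonempty subsets of $V$ (no multiple edges), with no isolated vertices. $G$ is $k$-uniform if every edge has $k$ vertices, and $d$-regular if every vertex lies in exactly $d$ edges. $G$ is connected if any two vertices are joined by a walk $v_0e_1v_1\dots e_tv_t$ with $\{v_{i-1},v_i\}\subseteq e_i$. For $k$ even, a $k$-uniform hypergraph $G$ is odd-bipartite if there is a bipartition $\{U,U^c\}$ of $V(G)$ such that every edge meets $U$ (and hence $U^c$) in an odd number of vertices. A $k$-uniform hypergraph ($k$ even) is minimal non-odd-bipartite if it is not odd-bipartite but $G-e$ (delete the edge $e$ from $E(G)$) is odd-bipartite for every edge $e$. -}

module Defs where

open import Data.Nat using (ℕ; _*_; _%_; _/_)
open import Data.Bool using (Bool; true; false; _∨_)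
open import Data.Fin using (Fin; quotient)
open import Data.Fin.Subset using (Subset; _∈_; _∩_; ∣_∣; Nonempty)
open import Data.Fin.Properties using (_≟_)
open import Data.Vec using (lookup; tabulate)
open import Data.Product using (Σ; ∃; _×_; proj₁)
open import Relation.Nullary using (¬_; does)
open import Relation.Binary.PropositionalEquality using (_≡_; _≢_)
open import Relation.Binary.Construct.Closure.ReflexiveTransitive using (Star)
open import Function.Bundles using (_↔_; _⇔_; Inverse)
open import Function.Definitions using (Injective)

Even : ℕ → Set
Even n = n % 2 ≡ 0

Odd : ℕ → Set
Odd n = n % 2 ≡ 1

-- The edge *set* is the image
-- of E; distinctness of edges (no multiple edges) is injectivity of E.
IsHypergraph : ∀ {n m} → (Fin m → Subset n) → Set
IsHypergraph {n} {m} E =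
  Injective _≡_ _≡_ E
  × (∀ (t : Fin m) → Nonempty (E t))
  × (∀ (v : Fin n) → ∃ λ (t : Fin m) → v ∈ E t)

Uniform : ∀ {n m} → ℕ → (Fin m → Subset n) → Set
Uniform {n} {m} k E = ∀ (t : Fin m) → ∣ E t ∣ ≡ k

degree : ∀ {n m} → (Fin m → Subset n) → Fin n → ℕ
degree E v = ∣ tabulate (λ t → lookup (E t) v) ∣

Regular : ∀ {n m} → ℕ → (Fin m → Subset n) → Set
Regular {n} {m} d E = ∀ (v : Fin n) → degree E v ≡ d

Adj : ∀ {n m} → (Fin m → Subset n) → Fin n → Fin n → Set
Adj {n} {m} E u v = ∃ λ (t : Fin m) → u ∈ E t × v ∈ E t

Connected : ∀ {n m} → (Fin m → Subset n) → Set
Connected {n} E = ∀ (u v : Fin n) → Star (Adj E) u v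

-- odd-bipartite: some U ⊆ V meets every edge in an odd number of vertices
-- (edge family indexed by an arbitrary type I, so that deleted-edge
-- hypergraphs can be expressed)
OddBipartite : ∀ {n} {I : Set} → (I → Subset n) → Set
OddBipartite {n} {I} E = ∃ λ (U : Subset n) → ∀ (i : I) → Odd ∣ E i ∩ U ∣

deleteEdge : ∀ {n m} → (Fin m → Subset n) → (e : Fin m) →
             (Σ (Fin m) (λ t → t ≢ e) → Subset n)
deleteEdge E e p = E (proj₁ p)

MinimalNonOddBipartite : ∀ {n m} → (Fin m → Subset n) → Set
MinimalNonOddBipartite {n} {m} E =
  ¬ OddBipartite E × (∀ (e : Fin m) → OddBipartite (deleteEdge E e))

Isomorphic : ∀ {n n' m m'} → (Fin m → Subset n) → (Fin m' → Subset n') → Set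
Isomorphic {n} {n'} {m} {m'} E E' =
  ∃ λ (σ : Fin n ↔ Fin n') → ∃ λ (π : Fin m ↔ Fin m') →
    ∀ (v : Fin n) (t : Fin m) →
      (v ∈ E t) ⇔ (Inverse.to σ v ∈ E' (Inverse.to π t))

-- The construction, with h = k/2, vertex set [n] = Fin (m * h)
-- (0-indexed: V_t = {h t, …, h t + h - 1}), new symbols
-- e_t^j = (t , j) ∈ Fin m × Fin h, E_t = {t} × Fin h.

Vblock : (m h : ℕ) → Fin m → Subset (m * h)
Vblock m h t = tabulate (λ v → does (quotient h v ≟ t))

-- A perfect matching of \hat K_{n,n}: a bijection between vertices and
-- symbols such that no vertex of V_t is matched to a symbol of E_t.
record Matching (m h : ℕ) : Set where
  field
    match   : Fin (m * h) ↔ (Fin m × Fin h)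
    avoids  : ∀ (v : Fin (m * h)) →
              quotient h v ≢ proj₁ (Inverse.to match v)

Wset : ∀ {m h} → Matching m h → Fin m → Subset (m * h)
Wset {m} {h} M t =
  tabulate (λ v → does (proj₁ (Inverse.to (Matching.match M) v) ≟ t))

Admissible : ∀ {m h} → Matching m h → Set
Admissible {m} {h} M = ∀ (s t : Fin m) → s ≢ t →
  Wset M t ≡ Vblock m h s → ¬ (Wset M s ≡ Vblock m h t)

constructed : ∀ {m h} → Matching m h → Fin m → Subset (m * h)
constructed {m} {h} M t =
  tabulate (λ v → lookup (Vblock m h t) v ∨ lookup (Wset M t) v)

-- A 2-regular hypergraph is a multigraph whose nodes are its edges and whose arcs are its
-- vertices. For odd m it is never odd-bipartite: ∑ₜ ∣ E t ∩ U ∣ is a sum of m odd numbers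
-- but also equals 2 ∣ U ∣. Vertex sets meeting the edges in given parities add up by
-- symmetric difference, and a vertex shared by the edges a and b meets exactly a and b
-- oddly; chaining along walks, connectivity makes the pattern δ a + δ b realizable for all
-- a, b, and summing δ t + δ e over all t shows that G - e is odd-bipartite. Conversely, if
-- u and v were not connected, odd-bipartitions of G - eᵥ and G - eᵤ (with v ∈ eᵥ, u ∈ eᵤ)
-- glue along the component of u into one of G. Finally every node of the multigraph has
-- degree k, so an Euler orientation makes each edge the tail of k/2 vertices and the head of
-- k/2 vertices; relabelling the tails of t as the block V t and matching the heads of t to
-- the symbols of E t realizes G as the construction, and distinct edges give admissibility.

module Submission where

open import Defs
open import Data.Nat using (ℕ; zero; suc; _+_; _*_; _≤_; _≰_; _<_; _/_; _%_; z≤n; s≤s; parity)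
import Data.Nat.Properties as ℕ
import Data.Nat.DivMod as DivMod
open import Data.Parity.Base using (Parity; 0ℙ; 1ℙ) renaming (_+_ to _ℙ+_)
import Data.Parity.Properties as ℙ
open import Algebra.Properties.CommutativeSemigroup ℙ.+-commutativeSemigroup using (interchange)
import Algebra.Properties.CommutativeSemigroup ℕ.+-commutativeSemigroup as ℕ+
open import Data.Bool using (Bool; true; false; _∧_; _∨_; _xor_; if_then_else_)
import Data.Bool.Properties as Bool
open import Data.Fin using (Fin; zero; suc; fromℕ<; punchOut; combine; quotient) renaming (_<_ to _<ᶠ_)
import Data.Fin.Properties as Fin
open import Data.Fin.Properties using (_≟_; any?) renaming (_<?_ to _<ᶠ?_)
open import Data.Fin.Subset using (Subset; _∈_; _∉_; _⊆_; _⊂_; _∩_; ∣_∣; ⊥; ⁅_⁆; Nonempty)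
open import Data.Fin.Subset.Properties using (_∈?_)
import Data.Fin.Subset.Properties as Subset
open import Data.Vec using ([]; _∷_; lookup; tabulate; zipWith; here; there)
import Data.Vec.Properties as Vec
open import Data.List using (List; []; _∷_; _++_)
import Data.List as List
import Data.Nat.ListAction as ListAction
import Data.Nat.ListAction.Properties as ListAction
open import Data.List.Relation.Binary.Pointwise using (Pointwise; []; _∷_)
import Data.List.Relation.Binary.Pointwise as Pointwise
open import Data.List.Relation.Binary.Permutation.Propositional using (_↭_; prep; swap)
import Data.List.Relation.Binary.Permutation.Propositional as ↭
import Data.List.Relation.Binary.Permutation.Propositional.Properties as ↭
open import Data.Product using (∃; ∃₂; _×_; _,_; proj₁; proj₂)
open import Data.Sum using (_⊎_; inj₁; inj₂)
open import Relation.Nullary using (¬_; Dec; yes; no; does; contradiction)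
open import Relation.Nullary.Decidable using (dec-true; dec-false; ¬?; _×-dec_)
open import Relation.Binary using (Rel; Decidable; Tri; tri<; tri≈; tri>)
open import Relation.Binary.Construct.Closure.ReflexiveTransitive using (Star; ε; _◅_; _◅◅_)
open import Data.Nat.Tactic.RingSolver using (solve-∀)
open import Relation.Binary.PropositionalEquality
open import Function using (_∘_)
open import Function.Bundles using (_⇔_; mk⇔; Equivalence; _↔_; mk↔ₛ′; Inverse)
open import Function.Definitions using (Injective)
open import Function.Properties.Inverse using (↔-refl; ↔-sym; ↔-trans)
open import Algebra.Properties.CommutativeMonoid.Sum ℕ.+-0-commutativeMonoid
  using (sum; sum-syntax; sum-cong-≗; ∑-comm; ∑-distrib-+; sum-replicate-zero)

-- Parity and counting

𝟙 : Bool → ℕ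
𝟙 true  = 1
𝟙 false = 0

δ : ∀ {m} → Fin m → Fin m → ℕ
δ a b = 𝟙 (does (a ≟ b))

δ-refl : ∀ {m} (a : Fin m) → δ a a ≡ 1
δ-refl a = cong 𝟙 (dec-true (a ≟ a) refl)

δ-≢ : ∀ {m} {a b : Fin m} → a ≢ b → δ a b ≡ 0
δ-≢ {a = a} {b} a≢b = cong 𝟙 (dec-false (a ≟ b) a≢b)

Odd⇔parity≡1ℙ : ∀ n → Odd n ⇔ parity n ≡ 1ℙ
Odd⇔parity≡1ℙ zero          = mk⇔ (λ ()) (λ ())
Odd⇔parity≡1ℙ (suc zero)    = mk⇔ (λ _ → refl) (λ _ → refl)
Odd⇔parity≡1ℙ (suc (suc n)) = Odd⇔parity≡1ℙ n

parity-n+n : ∀ n → parity (n + n) ≡ 0ℙ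
parity-n+n n = trans (ℙ.+-homo-+ n n) (ℙ.p+p≡0ℙ (parity n))

parity-double+ : ∀ a b → parity (b + b + a) ≡ parity a
parity-double+ a b = trans (ℙ.+-homo-+ (b + b) a) (cong (_ℙ+ parity a) (parity-n+n b))

∑-const : ∀ {m} h → ∑[ i < m ] h ≡ m * h
∑-const {zero}  h = refl
∑-const {suc m} h = cong (h +_) (∑-const {m} h)

∑-δˡ : ∀ {m} (c : Fin m) → ∑[ t < m ] δ c t ≡ 1
∑-δˡ {suc m} zero    = cong suc (sum-replicate-zero m)
∑-δˡ {suc m} (suc c) = ∑-δˡ c

∑-δʳ : ∀ {m} (c : Fin m) → ∑[ t < m ] δ t c ≡ 1
∑-δʳ {suc m} zero    = cong suc (sum-replicate-zero m)
∑-δʳ {suc m} (suc c) = ∑-δʳ c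

parity-∑-cong : ∀ {m} (f g : Fin m → ℕ) → (∀ i → parity (f i) ≡ parity (g i)) →
                parity (sum f) ≡ parity (sum g)
parity-∑-cong {zero}  f g p = refl
parity-∑-cong {suc m} f g p = begin
  parity (f zero + sum (f ∘ suc))         ≡⟨ ℙ.+-homo-+ (f zero) _ ⟩
  parity (f zero) ℙ+ parity (sum (f ∘ suc)) ≡⟨ cong₂ _ℙ+_ (p zero) (parity-∑-cong _ _ (p ∘ suc)) ⟩
  parity (g zero) ℙ+ parity (sum (g ∘ suc)) ≡⟨ ℙ.+-homo-+ (g zero) _ ⟨
  parity (g zero + sum (g ∘ suc))         ∎
  where open ≡-Reasoning

∣p∣≡∑𝟙 : ∀ {n} (p : Subset n) → ∣ p ∣ ≡ ∑[ i < n ] 𝟙 (lookup p i)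
∣p∣≡∑𝟙 []          = refl
∣p∣≡∑𝟙 (true ∷ p)  = cong suc (∣p∣≡∑𝟙 p)
∣p∣≡∑𝟙 (false ∷ p) = ∣p∣≡∑𝟙 p

∣p∩q∣≡∑𝟙 : ∀ {n} (p q : Subset n) → ∣ p ∩ q ∣ ≡ ∑[ i < n ] 𝟙 (lookup p i ∧ lookup q i)
∣p∩q∣≡∑𝟙 p q = trans (∣p∣≡∑𝟙 (p ∩ q)) (sum-cong-≗ (λ i → cong 𝟙 (Vec.lookup-zipWith _∧_ i p q)))

degree≡∑𝟙 : ∀ {n m} (E : Fin m → Subset n) v → degree E v ≡ ∑[ t < m ] 𝟙 (lookup (E t) v)
degree≡∑𝟙 E v = trans (∣p∣≡∑𝟙 (tabulate (λ t → lookup (E t) v)))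
  (sum-cong-≗ (λ t → cong 𝟙 (Vec.lookup∘tabulate (λ t → lookup (E t) v) t)))

∑∣E∩U∣≡∑degree : ∀ {n m} (E : Fin m → Subset n) (U : Subset n) →
  ∑[ t < m ] ∣ E t ∩ U ∣ ≡ ∑[ v < n ] (if lookup U v then degree E v else 0)
∑∣E∩U∣≡∑degree {n} {m} E U = begin
  ∑[ t < m ] ∣ E t ∩ U ∣                                ≡⟨ sum-cong-≗ (λ t → ∣p∩q∣≡∑𝟙 (E t) U) ⟩
  ∑[ t < m ] ∑[ v < n ] 𝟙 (lookup (E t) v ∧ lookup U v) ≡⟨ ∑-comm (λ t v → 𝟙 (lookup (E t) v ∧ lookup U v)) ⟩
  ∑[ v < n ] ∑[ t < m ] 𝟙 (lookup (E t) v ∧ lookup U v) ≡⟨ sum-cong-≗ inner ⟩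
  ∑[ v < n ] (if lookup U v then degree E v else 0)     ∎
  where
  open ≡-Reasoning
  inner : ∀ v → ∑[ t < m ] 𝟙 (lookup (E t) v ∧ lookup U v) ≡ (if lookup U v then degree E v else 0)
  inner v with lookup U v
  ... | true  = trans (sum-cong-≗ (λ t → cong 𝟙 (Bool.∧-identityʳ (lookup (E t) v)))) (sym (degree≡∑𝟙 E v))
  ... | false = trans (sum-cong-≗ (λ t → cong 𝟙 (Bool.∧-zeroʳ (lookup (E t) v)))) (sum-replicate-zero m)

2-regular⇒¬OddBipartite : ∀ {n m} (E : Fin m → Subset n) → Odd m → Regular 2 E → ¬ OddBipartite E
2-regular⇒¬OddBipartite {n} {m} E odd-m reg (U , odd) = ℙ.p≢p⁻¹ 1ℙ (begin
  1ℙ                                                         ≡⟨ Equivalence.to (Odd⇔parity≡1ℙ m) odd-m ⟨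
  parity m                                                   ≡⟨ cong parity (ℕ.*-identityʳ m) ⟨
  parity (m * 1)                                             ≡⟨ cong parity (∑-const {m} 1) ⟨
  parity (∑[ t < m ] 1)                                      ≡⟨ parity-∑-cong _ _ (λ t → Equivalence.to (Odd⇔parity≡1ℙ ∣ E t ∩ U ∣) (odd t)) ⟨
  parity (∑[ t < m ] ∣ E t ∩ U ∣)                            ≡⟨ cong parity (∑∣E∩U∣≡∑degree E U) ⟩
  parity (∑[ v < n ] (if lookup U v then degree E v else 0)) ≡⟨ parity-∑-cong _ _ even ⟩
  parity (∑[ v < n ] 0)                                      ≡⟨ cong parity (sum-replicate-zero n) ⟩
  0ℙ                                                         ∎)
  where
  open ≡-Reasoning
  even : ∀ v → parity (if lookup U v then degree E v else 0) ≡ parity 0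
  even v with lookup U v
  ... | true  = cong parity (reg v)
  ... | false = refl

-- Two-regular hypergraphs

∣p∣≡0⇒lookup≡false : ∀ {n} (p : Subset n) → ∣ p ∣ ≡ 0 → ∀ t → lookup p t ≡ false
∣p∣≡0⇒lookup≡false (false ∷ p) e zero    = refl
∣p∣≡0⇒lookup≡false (false ∷ p) e (suc t) = ∣p∣≡0⇒lookup≡false p e t

∣p∣≡1⇒singleton : ∀ {n} (p : Subset n) → ∣ p ∣ ≡ 1 → ∃ λ a → ∀ t → lookup p t ≡ does (a ≟ t)
∣p∣≡1⇒singleton (true ∷ p) e =
  zero , λ { zero → refl ; (suc t) → ∣p∣≡0⇒lookup≡false p (ℕ.suc-injective e) t }
∣p∣≡1⇒singleton (false ∷ p) e with ∣p∣≡1⇒singleton p e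
... | a , p≡⁅a⁆ = suc a , λ { zero → refl ; (suc t) → p≡⁅a⁆ t }

∣p∣≡2⇒pair : ∀ {n} (p : Subset n) → ∣ p ∣ ≡ 2 →
  ∃₂ λ a b → a ≢ b × ∀ t → lookup p t ≡ does (a ≟ t) ∨ does (b ≟ t)
∣p∣≡2⇒pair (true ∷ p) e with ∣p∣≡1⇒singleton p (ℕ.suc-injective e)
... | b , p≡⁅b⁆ = zero , suc b , (λ ()) , λ { zero → refl ; (suc t) → p≡⁅b⁆ t }
∣p∣≡2⇒pair (false ∷ p) e with ∣p∣≡2⇒pair p e
... | a , b , a≢b , p≡⁅a,b⁆ = suc a , suc b , a≢b ∘ Fin.suc-injective , λ { zero → refl ; (suc t) → p≡⁅a,b⁆ t }

𝟙-∨ : ∀ {m} {a b : Fin m} → a ≢ b → ∀ t → 𝟙 (does (a ≟ t) ∨ does (b ≟ t)) ≡ δ a t + δ b t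
𝟙-∨ {a = a} {b} a≢b t with a ≟ t | b ≟ t
... | yes refl | yes refl = contradiction refl a≢b
... | yes _    | no _     = refl
... | no _     | yes _    = refl
... | no _     | no _     = refl

module TwoRegular {n m} (E : Fin m → Subset n) (reg : Regular 2 E) where

  private
    ends : ∀ v → ∃₂ λ a b → a ≢ b ×
      ∀ t → lookup (tabulate (λ t → lookup (E t) v)) t ≡ does (a ≟ t) ∨ does (b ≟ t)
    ends v = ∣p∣≡2⇒pair (tabulate (λ t → lookup (E t) v)) (reg v)

  edge₁ edge₂ : Fin n → Fin m
  edge₁ v = proj₁ (ends v)
  edge₂ v = proj₁ (proj₂ (ends v))

  edge₁≢edge₂ : ∀ v → edge₁ v ≢ edge₂ v
  edge₁≢edge₂ v = proj₁ (proj₂ (proj₂ (ends v)))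

  lookup-E : ∀ v t → lookup (E t) v ≡ does (edge₁ v ≟ t) ∨ does (edge₂ v ≟ t)
  lookup-E v t = trans (sym (Vec.lookup∘tabulate (λ t → lookup (E t) v) t)) (proj₂ (proj₂ (proj₂ (ends v))) t)

  𝟙-lookup-E : ∀ v t → 𝟙 (lookup (E t) v) ≡ δ (edge₁ v) t + δ (edge₂ v) t
  𝟙-lookup-E v t = trans (cong 𝟙 (lookup-E v t)) (𝟙-∨ (edge₁≢edge₂ v) t)

  ∑-ends≡∣E∣ : ∀ t → ∑[ v < n ] (δ (edge₁ v) t + δ (edge₂ v) t) ≡ ∣ E t ∣
  ∑-ends≡∣E∣ t = trans (sum-cong-≗ {n} (λ v → sym (𝟙-lookup-E v t))) (sym (∣p∣≡∑𝟙 (E t)))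

  ∈E⇒edge₁⊎edge₂ : ∀ {v t} → v ∈ E t → t ≡ edge₁ v ⊎ t ≡ edge₂ v
  ∈E⇒edge₁⊎edge₂ {v} {t} v∈Et with edge₁ v ≟ t | edge₂ v ≟ t | trans (sym (lookup-E v t)) (Vec.[]=⇒lookup v∈Et)
  ... | yes e₁≡t | _        | _  = inj₁ (sym e₁≡t)
  ... | no _     | yes e₂≡t | _  = inj₂ (sym e₂≡t)
  ... | no _     | no _     | ()

-- Deleting an edge of a connected 2-regular hypergraph

_⊕_ : ∀ {n} → Subset n → Subset n → Subset n
_⊕_ = zipWith _xor_

∣∷∣ : ∀ {n} b (p : Subset n) → ∣ b ∷ p ∣ ≡ 𝟙 b + ∣ p ∣
∣∷∣ true  p = refl
∣∷∣ false p = refl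

parity-∣p∩[X⊕Y]∣ : ∀ {n} (p X Y : Subset n) →
  parity ∣ p ∩ (X ⊕ Y) ∣ ≡ parity ∣ p ∩ X ∣ ℙ+ parity ∣ p ∩ Y ∣
parity-∣p∩[X⊕Y]∣ []      []      []      = refl
parity-∣p∩[X⊕Y]∣ (b ∷ p) (x ∷ X) (y ∷ Y) = begin
  parity ∣ (b ∧ (x xor y)) ∷ p ∩ (X ⊕ Y) ∣             ≡⟨ parity-∣∷∣ (b ∧ (x xor y)) (p ∩ (X ⊕ Y)) ⟩
  parity (𝟙 (b ∧ (x xor y))) ℙ+ parity ∣ p ∩ (X ⊕ Y) ∣ ≡⟨ cong₂ _ℙ+_ (head b x y) (parity-∣p∩[X⊕Y]∣ p X Y) ⟩
  (bx ℙ+ by) ℙ+ (pX ℙ+ pY)                             ≡⟨ interchange bx by pX pY ⟩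
  (bx ℙ+ pX) ℙ+ (by ℙ+ pY)                             ≡⟨ cong₂ _ℙ+_ (parity-∣∷∣ (b ∧ x) (p ∩ X)) (parity-∣∷∣ (b ∧ y) (p ∩ Y)) ⟨
  parity ∣ (b ∧ x) ∷ p ∩ X ∣ ℙ+ parity ∣ (b ∧ y) ∷ p ∩ Y ∣ ∎
  where
  open ≡-Reasoning
  bx by pX pY : Parity
  bx = parity (𝟙 (b ∧ x))
  by = parity (𝟙 (b ∧ y))
  pX = parity ∣ p ∩ X ∣
  pY = parity ∣ p ∩ Y ∣
  parity-∣∷∣ : ∀ {n} c (q : Subset n) → parity ∣ c ∷ q ∣ ≡ parity (𝟙 c) ℙ+ parity ∣ q ∣
  parity-∣∷∣ c q = trans (cong parity (∣∷∣ c q)) (ℙ.+-homo-+ (𝟙 c) ∣ q ∣)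
  head : ∀ b x y → parity (𝟙 (b ∧ (x xor y))) ≡ parity (𝟙 (b ∧ x)) ℙ+ parity (𝟙 (b ∧ y))
  head false _     _     = refl
  head true  false _     = refl
  head true  true  false = refl
  head true  true  true  = refl

∣p∩⊥∣≡0 : ∀ {n} (p : Subset n) → ∣ p ∩ ⊥ ∣ ≡ 0
∣p∩⊥∣≡0 {n} p = trans (cong ∣_∣ (Subset.∩-zeroʳ p)) (Subset.∣⊥∣≡0 n)

∣p∩⁅x⁆∣≡𝟙 : ∀ {n} (p : Subset n) x → ∣ p ∩ ⁅ x ⁆ ∣ ≡ 𝟙 (lookup p x)
∣p∩⁅x⁆∣≡𝟙 (b ∷ p) zero    = begin
  ∣ (b ∧ true) ∷ p ∩ ⊥ ∣ ≡⟨ ∣∷∣ (b ∧ true) (p ∩ ⊥) ⟩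
  𝟙 (b ∧ true) + ∣ p ∩ ⊥ ∣ ≡⟨ cong₂ _+_ (cong 𝟙 (Bool.∧-identityʳ b)) (∣p∩⊥∣≡0 p) ⟩
  𝟙 b + 0 ≡⟨ ℕ.+-identityʳ (𝟙 b) ⟩
  𝟙 b ∎
  where open ≡-Reasoning
∣p∩⁅x⁆∣≡𝟙 (b ∷ p) (suc x) = trans (∣∷∣ (b ∧ false) (p ∩ ⁅ x ⁆))
  (trans (cong (_+ ∣ p ∩ ⁅ x ⁆ ∣) (cong 𝟙 (Bool.∧-zeroʳ b))) (∣p∩⁅x⁆∣≡𝟙 p x))

parity-cancel : ∀ a b c → parity (a + b + (b + c)) ≡ parity (a + c)
parity-cancel a b c = begin
  parity (a + b + (b + c))             ≡⟨ cong parity (rearrange a b c) ⟩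
  parity (a + c + (b + b))             ≡⟨ ℙ.+-homo-+ (a + c) (b + b) ⟩
  parity (a + c) ℙ+ parity (b + b)     ≡⟨ cong (parity (a + c) ℙ+_) (parity-n+n b) ⟩
  parity (a + c) ℙ+ 0ℙ                 ≡⟨ ℙ.+-identityʳ (parity (a + c)) ⟩
  parity (a + c)                       ∎
  where
  open ≡-Reasoning
  rearrange : ∀ a b c → a + b + (b + c) ≡ a + c + (b + b)
  rearrange = solve-∀

module Realizability {n m} (E : Fin m → Subset n) where

  record Realizable (T : Fin m → ℕ) : Set where
    constructor realizedBy
    field
      vertices : Subset n
      realizes : ∀ s → parity ∣ E s ∩ vertices ∣ ≡ parity (T s)

  realizable-cong : ∀ {T T′} → (∀ s → parity (T s) ≡ parity (T′ s)) → Realizable T → Realizable T′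
  realizable-cong T≈T′ (realizedBy X X-realizes) = realizedBy X λ s → trans (X-realizes s) (T≈T′ s)

  realizable-0 : Realizable (λ _ → 0)
  realizable-0 = realizedBy ⊥ λ s → cong parity (∣p∩⊥∣≡0 (E s))

  realizable-+ : ∀ {T T′} → Realizable T → Realizable T′ → Realizable (λ s → T s + T′ s)
  realizable-+ {T} {T′} (realizedBy X X-realizes) (realizedBy Y Y-realizes) = realizedBy (X ⊕ Y) λ s → begin
    parity ∣ E s ∩ (X ⊕ Y) ∣                ≡⟨ parity-∣p∩[X⊕Y]∣ (E s) X Y ⟩
    parity ∣ E s ∩ X ∣ ℙ+ parity ∣ E s ∩ Y ∣ ≡⟨ cong₂ _ℙ+_ (X-realizes s) (Y-realizes s) ⟩
    parity (T s) ℙ+ parity (T′ s)           ≡⟨ ℙ.+-homo-+ (T s) (T′ s) ⟨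
    parity (T s + T′ s)                     ∎
    where open ≡-Reasoning

  realizable-∑ : ∀ {k} (T : Fin k → Fin m → ℕ) → (∀ i → Realizable (T i)) →
                 Realizable (λ s → ∑[ i < k ] T i s)
  realizable-∑ {zero}  T realizable = realizable-0
  realizable-∑ {suc k} T realizable =
    realizable-+ (realizable zero) (realizable-∑ (T ∘ suc) (realizable ∘ suc))

  Linked : Fin m → Fin m → Set
  Linked a b = Realizable (λ s → δ a s + δ b s)

  linked-refl : ∀ {a} → Linked a a
  linked-refl {a} = realizable-cong (λ s → sym (parity-n+n (δ a s))) realizable-0

  linked-sym : ∀ {a b} → Linked a b → Linked b a
  linked-sym {a} {b} = realizable-cong (λ s → cong parity (ℕ.+-comm (δ a s) (δ b s)))

  linked-trans : ∀ {a b c} → Linked a b → Linked b c → Linked a c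
  linked-trans {a} {b} {c} ab bc =
    realizable-cong (λ s → parity-cancel (δ a s) (δ b s) (δ c s)) (realizable-+ ab bc)

  module _ (reg : Regular 2 E) where
    open TwoRegular E reg

    linked-edge₁ : ∀ {w a} → w ∈ E a → Linked a (edge₁ w)
    linked-edge₁ {w} w∈Ea with ∈E⇒edge₁⊎edge₂ w∈Ea
    ... | inj₁ refl = linked-refl {edge₁ w}
    ... | inj₂ refl = linked-sym {edge₁ w} {edge₂ w}
      (realizedBy ⁅ w ⁆ λ s → cong parity (trans (∣p∩⁅x⁆∣≡𝟙 (E s) w) (𝟙-lookup-E w s)))

    linked-share : ∀ {w a b} → w ∈ E a → w ∈ E b → Linked a b
    linked-share {w} {a} {b} w∈Ea w∈Eb =
      linked-trans {a} {edge₁ w} {b} (linked-edge₁ w∈Ea) (linked-sym {b} {edge₁ w} (linked-edge₁ w∈Eb))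

    linked-walk : ∀ {u v a b} → Star (Adj E) u v → u ∈ E a → v ∈ E b → Linked a b
    linked-walk ε                         u∈Ea u∈Eb = linked-share u∈Ea u∈Eb
    linked-walk {a = a} {b} ((c , u∈Ec , w∈Ec) ◅ walk) u∈Ea v∈Eb =
      linked-trans {a} {c} {b} (linked-share u∈Ea u∈Ec) (linked-walk walk w∈Ec v∈Eb)

connected⇒oddBipartite-deleteEdge : ∀ {n m} (E : Fin m → Subset n) → Regular 2 E →
  (∀ t → Nonempty (E t)) → Connected E → ∀ e → OddBipartite (deleteEdge E e)
connected⇒oddBipartite-deleteEdge {n} {m} E reg nonempty connected e =
  odd-off-e (realizable-∑ (λ t s → δ t s + δ e s) linked-to-e)
  where
  open Realizability E

  linked-to-e : ∀ t → Linked t e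
  linked-to-e t with nonempty t | nonempty e
  ... | u , u∈Et | v , v∈Ee = linked-walk reg (connected u v) u∈Et v∈Ee

  ∑≡1 : ∀ {s} → s ≢ e → ∑[ t < m ] (δ t s + δ e s) ≡ 1
  ∑≡1 {s} s≢e = begin
    ∑[ t < m ] (δ t s + δ e s)           ≡⟨ ∑-distrib-+ (λ t → δ t s) (λ _ → δ e s) ⟩
    ∑[ t < m ] δ t s + ∑[ t < m ] δ e s  ≡⟨ cong₂ _+_ (∑-δʳ s) (sum-cong-≗ {m} (λ _ → δ-≢ (s≢e ∘ sym))) ⟩
    1 + ∑[ t < m ] 0                     ≡⟨ cong (1 +_) (sum-replicate-zero m) ⟩
    1                                    ∎
    where open ≡-Reasoning

  odd-off-e : Realizable (λ s → ∑[ t < m ] (δ t s + δ e s)) → OddBipartite (deleteEdge E e)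
  odd-off-e (realizedBy X X-realizes) = X , λ (s , s≢e) →
    Equivalence.from (Odd⇔parity≡1ℙ ∣ E s ∩ X ∣) (trans (X-realizes s) (cong parity (∑≡1 s≢e)))

-- Connectivity of minimal non-odd-bipartite hypergraphs

∈-tabulate⁺ : ∀ {n} {f : Fin n → Bool} {y} → f y ≡ true → y ∈ tabulate f
∈-tabulate⁺ {f = f} {y} fy≡true = Vec.lookup⇒[]= y (tabulate f) (trans (Vec.lookup∘tabulate f y) fy≡true)

∈-tabulate⁻ : ∀ {n} {f : Fin n → Bool} {y} → y ∈ tabulate f → f y ≡ true
∈-tabulate⁻ {f = f} {y} y∈ = trans (sym (Vec.lookup∘tabulate f y)) (Vec.[]=⇒lookup y∈)

∩-cong-on : ∀ {n} (p : Subset n) {A B : Subset n} → (∀ {y} → y ∈ p → lookup A y ≡ lookup B y) → p ∩ A ≡ p ∩ B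
∩-cong-on []          {[]}    {[]}    A≡B = refl
∩-cong-on (true ∷ p)  {a ∷ A} {b ∷ B} A≡B = cong₂ _∷_ (A≡B here) (∩-cong-on p (A≡B ∘ there))
∩-cong-on (false ∷ p) {a ∷ A} {b ∷ B} A≡B = cong (false ∷_) (∩-cong-on p (A≡B ∘ there))

-- The vertices reachable from u under a decidable relation, computed by n rounds of
-- breadth-first search: each round either adds a vertex or has reached a closed set.
module Reachability {n ℓ} {R : Rel (Fin n) ℓ} (R? : Decidable R) where

  Closed : Subset n → Set ℓ
  Closed C = ∀ {x y} → x ∈ C → R x y → y ∈ C

  step : Subset n → Subset n
  step C = tabulate λ y → does (y ∈? C) ∨ does (any? λ x → x ∈? C ×-dec R? x y)

  ⊆-step : ∀ {C} → C ⊆ step C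
  ⊆-step {C} {y} y∈C = ∈-tabulate⁺ (cong (_∨ does (any? λ x → x ∈? C ×-dec R? x y)) (dec-true (y ∈? C) y∈C))

  R-step : ∀ {C x y} → x ∈ C → R x y → y ∈ step C
  R-step {C} {x} {y} x∈C Rxy = ∈-tabulate⁺ (trans
    (cong (does (y ∈? C) ∨_) (dec-true (any? λ x → x ∈? C ×-dec R? x y) (x , x∈C , Rxy)))
    (Bool.∨-zeroʳ (does (y ∈? C))))

  step-⊆ : ∀ {C y} → y ∈ step C → y ∈ C ⊎ ∃ λ x → x ∈ C × R x y
  step-⊆ {C} {y} y∈ with y ∈? C | any? (λ x → x ∈? C ×-dec R? x y) | ∈-tabulate⁻ y∈
  ... | yes y∈C | _       | _ = inj₁ y∈C
  ... | no _    | yes Rxy | _ = inj₂ Rxy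
  ... | no _    | no _    | ()

  closed-step : ∀ {C} → Closed C → Closed (step C)
  closed-step closed x∈ Rxy with step-⊆ x∈
  ... | inj₁ x∈C             = ⊆-step (closed x∈C Rxy)
  ... | inj₂ (z , z∈C , Rzx) = ⊆-step (closed (closed z∈C Rzx) Rxy)

  closed⊎⊂step : ∀ C → Closed C ⊎ C ⊂ step C
  closed⊎⊂step C with any? (λ y → y ∈? step C ×-dec ¬? (y ∈? C))
  ... | yes (y , y∈ , y∉C) = inj₂ (⊆-step , y , y∈ , y∉C)
  ... | no ¬new            = inj₁ closed
    where
    closed : Closed C
    closed {y = y} x∈C Rxy with y ∈? C
    ... | yes y∈C = y∈C
    ... | no y∉C  = contradiction (y , R-step x∈C Rxy , y∉C) ¬new

  reach : Fin n → ℕ → Subset n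
  reach u zero    = ⁅ u ⁆
  reach u (suc i) = step (reach u i)

  closed⊎large : ∀ u i → Closed (reach u i) ⊎ i < ∣ reach u i ∣
  closed⊎large u zero = inj₂ (ℕ.≤-reflexive (sym (Subset.∣⁅x⁆∣≡1 u)))
  closed⊎large u (suc i) with closed⊎large u i
  ... | inj₁ closed = inj₁ (closed-step closed)
  ... | inj₂ large with closed⊎⊂step (reach u i)
  ...   | inj₁ closed = inj₁ (closed-step closed)
  ...   | inj₂ ⊂step  = inj₂ (ℕ.≤-<-trans large (Subset.p⊂q⇒∣p∣<∣q∣ ⊂step))

  component : Fin n → Subset n
  component u = reach u n

  component-closed : ∀ u → Closed (component u)
  component-closed u with closed⊎large u n
  ... | inj₁ closed = closed
  ... | inj₂ large  = contradiction (Subset.∣p∣≤n (reach u n)) (ℕ.<⇒≱ large)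

  ∈-reach⇒Star : ∀ {u y} i → y ∈ reach u i → Star R u y
  ∈-reach⇒Star {u} zero y∈ with Subset.x∈⁅y⁆⇒x≡y u y∈
  ... | refl = ε
  ∈-reach⇒Star (suc i) y∈ with step-⊆ y∈
  ... | inj₁ y∈reach         = ∈-reach⇒Star i y∈reach
  ... | inj₂ (x , x∈ , Rxy) = ∈-reach⇒Star i x∈ ◅◅ (Rxy ◅ ε)

  ∈-component⇒Star : ∀ {u y} → y ∈ component u → Star R u y
  ∈-component⇒Star = ∈-reach⇒Star n

  ∈-component : ∀ u → u ∈ component u
  ∈-component u = ∈-reach n
    where
    ∈-reach : ∀ i → u ∈ reach u i
    ∈-reach zero    = Subset.x∈⁅x⁆ u
    ∈-reach (suc i) = ⊆-step (∈-reach i)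

Adj? : ∀ {n m} (E : Fin m → Subset n) → Decidable (Adj E)
Adj? E x y = any? λ t → x ∈? E t ×-dec y ∈? E t

minimalNonOddBipartite⇒connected : ∀ {n m} (E : Fin m → Subset n) →
  (∀ v → ∃ λ t → v ∈ E t) → MinimalNonOddBipartite E → Connected E
minimalNonOddBipartite⇒connected {n} {m} E covered (¬oddBipartite , oddBipartite-deleteEdge) u v =
  walk-to-v (v ∈? C)
  where
  open Reachability (Adj? E)

  C : Subset n
  C = component u

  eᵥ eᵤ : Fin m
  eᵥ = proj₁ (covered v)
  eᵤ = proj₁ (covered u)

  U₁ U₂ U : Subset n
  U₁ = proj₁ (oddBipartite-deleteEdge eᵥ)
  U₂ = proj₁ (oddBipartite-deleteEdge eᵤ)
  U  = tabulate λ y → if does (y ∈? C) then lookup U₁ y else lookup U₂ y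

  U-on-C : ∀ {y} → y ∈ C → lookup U₁ y ≡ lookup U y
  U-on-C {y} y∈C = sym (trans (Vec.lookup∘tabulate _ y)
    (cong (if_then lookup U₁ y else lookup U₂ y) (dec-true (y ∈? C) y∈C)))

  U-off-C : ∀ {y} → y ∉ C → lookup U₂ y ≡ lookup U y
  U-off-C {y} y∉C = sym (trans (Vec.lookup∘tabulate _ y)
    (cong (if_then lookup U₁ y else lookup U₂ y) (dec-false (y ∈? C) y∉C)))

  U-odd : v ∉ C → ∀ t → Odd ∣ E t ∩ U ∣
  U-odd v∉C t with any? (λ x → x ∈? E t ×-dec x ∈? C)
  ... | yes (x , x∈Et , x∈C) =
    subst (Odd ∘ ∣_∣) (∩-cong-on (E t) (U-on-C ∘ Et⊆C)) (proj₂ (oddBipartite-deleteEdge eᵥ) (t , t≢eᵥ))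
    where
    Et⊆C : E t ⊆ C
    Et⊆C y∈Et = component-closed u x∈C (t , x∈Et , y∈Et)
    t≢eᵥ : t ≢ eᵥ
    t≢eᵥ refl = v∉C (Et⊆C (proj₂ (covered v)))
  ... | no ¬meets =
    subst (Odd ∘ ∣_∣) (∩-cong-on (E t) (U-off-C ∘ Et∩C≡∅)) (proj₂ (oddBipartite-deleteEdge eᵤ) (t , t≢eᵤ))
    where
    Et∩C≡∅ : ∀ {y} → y ∈ E t → y ∉ C
    Et∩C≡∅ y∈Et y∈C = ¬meets (_ , y∈Et , y∈C)
    t≢eᵤ : t ≢ eᵤ
    t≢eᵤ refl = Et∩C≡∅ (proj₂ (covered u)) (∈-component u)

  walk-to-v : Dec (v ∈ C) → Star (Adj E) u v
  walk-to-v (yes v∈C) = ∈-component⇒Star v∈C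
  walk-to-v (no  v∉C) = contradiction (U , U-odd v∉C) ¬oddBipartite

-- Euler orientations

pointwise-++⁻ : ∀ {a b ℓ} {A : Set a} {B : Set b} {R : A → B → Set ℓ} xs {ys zs} →
  Pointwise R (xs ++ ys) zs → ∃₂ λ xs′ ys′ → zs ≡ xs′ ++ ys′ × Pointwise R xs xs′ × Pointwise R ys ys′
pointwise-++⁻ []       rs       = [] , _ , refl , [] , rs
pointwise-++⁻ (x ∷ xs) (r ∷ rs) with pointwise-++⁻ xs rs
... | xs′ , ys′ , refl , rs₁ , rs₂ = _ ∷ xs′ , ys′ , refl , r ∷ rs₁ , rs₂

pointwise-tabulate⁻ : ∀ {a b ℓ} {A : Set a} {B : Set b} {R : A → B → Set ℓ} {n} {f : Fin n → A} {ys} →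
  Pointwise R (List.tabulate f) ys → ∃ λ g → ys ≡ List.tabulate g × ∀ i → R (f i) (g i)
pointwise-tabulate⁻ {n = zero}  []       = (λ ()) , refl , λ ()
pointwise-tabulate⁻ {n = suc n} (r ∷ rs) with pointwise-tabulate⁻ rs
... | g , refl , f∼g = (λ { zero → _ ; (suc i) → g i }) , refl , λ { zero → r ; (suc i) → f∼g i }

-- A multigraph on Fin m is a list of arcs (tail , head), read as undirected edges.
module Orientation (m : ℕ) where

  Arc : Set
  Arc = Fin m × Fin m

  Reorients : Arc → Arc → Set
  Reorients (p , q) a = a ≡ (p , q) ⊎ a ≡ (q , p)

  weight : (Arc → ℕ) → List Arc → ℕ
  weight w L = ListAction.sum (List.map w L)

  weight-↭ : ∀ w {L L′} → L ↭ L′ → weight w L ≡ weight w L′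
  weight-↭ w L↭L′ = ListAction.sum-↭ (↭.map⁺ w L↭L′)

  tail-at head-at ends-at : Fin m → Arc → ℕ
  tail-at x (p , _) = δ p x
  head-at x (_ , q) = δ q x
  ends-at x (p , q) = δ p x + δ q x

  outdeg indeg deg : Fin m → List Arc → ℕ
  outdeg x = weight (tail-at x)
  indeg  x = weight (head-at x)
  deg    x = weight (ends-at x)

  Balanced : List Arc → Set
  Balanced L = ∀ x → outdeg x L ≡ indeg x L

  EvenDegrees : List Arc → Set
  EvenDegrees L = ∀ x → parity (deg x L) ≡ 0ℙ

  ends-reorient : ∀ {x p q a} → Reorients (p , q) a → δ (proj₁ a) x + δ (proj₂ a) x ≡ δ p x + δ q x
  ends-reorient         (inj₁ refl) = refl
  ends-reorient {x} {p} {q} (inj₂ refl) = ℕ.+-comm (δ q x) (δ p x)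

  reorients-both : ∀ {e a b} → Reorients e a → Reorients e b → Reorients a b
  reorients-both (inj₁ refl) (inj₁ refl) = inj₁ refl
  reorients-both (inj₁ refl) (inj₂ refl) = inj₂ refl
  reorients-both (inj₂ refl) (inj₁ refl) = inj₂ refl
  reorients-both (inj₂ refl) (inj₂ refl) = inj₁ refl

  balanced-↭ : ∀ {L L′} → L ↭ L′ → Balanced L → Balanced L′
  balanced-↭ L↭L′ bal x = trans (sym (weight-↭ (tail-at x) L↭L′)) (trans (bal x) (weight-↭ (head-at x) L↭L′))

  balanced-subdivide : ∀ {s p t L} → Balanced ((s , t) ∷ L) → Balanced ((s , p) ∷ (p , t) ∷ L)
  balanced-subdivide {s} {p} {t} {L} bal x = begin
    δ s x + (δ p x + outdeg x L) ≡⟨ ℕ+.x∙yz≈y∙xz (δ s x) (δ p x) _ ⟩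
    δ p x + (δ s x + outdeg x L) ≡⟨ cong (δ p x +_) (bal x) ⟩
    δ p x + (δ t x + indeg x L)  ∎
    where open ≡-Reasoning

  deg-merge : ∀ x p q c L → deg x ((p , q) ∷ (p , c) ∷ L) ≡ δ p x + δ p x + deg x ((c , q) ∷ L)
  deg-merge x p q c L = rearrange (δ p x) (δ q x) (δ c x) (deg x L)
    where
    rearrange : ∀ a b c d → a + b + (a + c + d) ≡ a + a + (c + b + d)
    rearrange = solve-∀

  Incident : Fin m → List Arc → Set
  Incident p L = ∃₂ λ pre post → ∃₂ λ c a → L ≡ pre ++ a ∷ post × Reorients (p , c) a

  incident? : ∀ p L → Incident p L ⊎ deg p L ≡ 0
  incident? p []            = inj₂ refl
  incident? p ((a , b) ∷ L) with a ≟ p | b ≟ p | incident? p L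
  ... | yes refl | _        | _ = inj₁ ([] , L , b , (a , b) , refl , inj₁ refl)
  ... | no _     | yes refl | _ = inj₁ ([] , L , a , (a , b) , refl , inj₂ refl)
  ... | no _     | no _     | inj₁ (pre , post , c , a′ , refl , r) = inj₁ ((a , b) ∷ pre , post , c , a′ , refl , r)
  ... | no _     | no _     | inj₂ deg≡0 = inj₂ deg≡0

  reorients-≢ : ∀ {p q a b} → Reorients (p , q) (a , b) → p ≢ q → a ≢ b
  reorients-≢ (inj₁ refl) p≢q = p≢q
  reorients-≢ (inj₂ refl) p≢q = p≢q ∘ sym

  ∨-reorient : ∀ {p q a b} → Reorients (p , q) (a , b) → ∀ t →
    does (p ≟ t) ∨ does (q ≟ t) ≡ does (a ≟ t) ∨ does (b ≟ t)
  ∨-reorient (inj₁ refl) t = refl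
  ∨-reorient {p} {q} (inj₂ refl) t = Bool.∨-comm (does (p ≟ t)) (does (q ≟ t))

  weight-tabulate : ∀ {k} (w : Arc → ℕ) (e : Fin k → Arc) → weight w (List.tabulate e) ≡ ∑[ i < k ] w (e i)
  weight-tabulate {zero}  w e = refl
  weight-tabulate {suc k} w e = cong (w (e zero) +_) (weight-tabulate w (e ∘ suc))

  even-merge : ∀ {p q c a} pre post → Reorients (p , c) a →
    EvenDegrees ((p , q) ∷ pre ++ a ∷ post) → EvenDegrees ((c , q) ∷ pre ++ post)
  even-merge {p} {q} {c} {a} pre post a∼pc even x = begin
    parity (deg x ((c , q) ∷ pre ++ post))                 ≡⟨ parity-double+ _ (δ p x) ⟨
    parity (δ p x + δ p x + deg x ((c , q) ∷ pre ++ post)) ≡⟨ cong parity (deg-merge x p q c (pre ++ post)) ⟨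
    parity (deg x ((p , q) ∷ (p , c) ∷ pre ++ post))        ≡⟨ cong (λ d → parity (δ p x + δ q x + (d + deg x (pre ++ post)))) (ends-reorient a∼pc) ⟨
    parity (deg x ((p , q) ∷ a ∷ pre ++ post))              ≡⟨ cong parity (weight-↭ (ends-at x) (prep (p , q) (↭.shift a pre post))) ⟨
    parity (deg x ((p , q) ∷ pre ++ a ∷ post))              ≡⟨ even x ⟩
    0ℙ                                                     ∎
    where open ≡-Reasoning

  split-orientation : ∀ {p q c a g} pre post → Reorients (p , c) a → Reorients (c , q) g →
    Balanced (g ∷ pre ++ post) →
    ∃₂ λ b₁ b₂ → Reorients (p , q) b₁ × Reorients a b₂ × Balanced (b₁ ∷ pre ++ b₂ ∷ post)
  split-orientation {p} {q} {c} pre post a∼pc (inj₁ refl) bal =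
    (p , q) , (c , p) , inj₁ refl , reorients-both a∼pc (inj₂ refl) ,
    balanced-↭ (↭.trans (swap (c , p) (p , q) ↭.refl) (prep (p , q) (↭.↭-sym (↭.shift (c , p) pre post))))
               (balanced-subdivide {c} {p} {q} {pre ++ post} bal)
  split-orientation {p} {q} {c} pre post a∼pc (inj₂ refl) bal =
    (q , p) , (p , c) , inj₂ refl , reorients-both a∼pc (inj₁ refl) ,
    balanced-↭ (prep (q , p) (↭.↭-sym (↭.shift (p , c) pre post)))
               (balanced-subdivide {q} {p} {c} {pre ++ post} bal)

  -- Induction on the number of arcs: a loop is removed; otherwise two arcs q — p — c at p
  -- are merged into c — q, and the orientation found for c — q is split back into a path
  -- through p.
  orient : ∀ k L → List.length L ≤ k → EvenDegrees L → ∃ λ L′ → Pointwise Reorients L L′ × Balanced L′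
  orient _       []            _         _    = [] , [] , λ _ → refl
  orient (suc k) ((p , q) ∷ L) (s≤s len) even with p ≟ q
  ... | yes refl with orient k L len (λ x → trans (sym (parity-double+ (deg x L) (δ p x))) (even x))
  ...   | L′ , L∼L′ , bal = (p , p) ∷ L′ , inj₁ refl ∷ L∼L′ , λ x → cong (δ p x +_) (bal x)
  orient (suc k) ((p , q) ∷ L) (s≤s len) even | no p≢q with incident? p L
  ... | inj₂ deg≡0 = contradiction (trans (cong parity (sym deg≡1)) (even p)) (ℙ.p≢p⁻¹ 1ℙ)
    where
    deg≡1 : deg p ((p , q) ∷ L) ≡ 1
    deg≡1 = cong₂ _+_ (cong₂ _+_ (δ-refl p) (δ-≢ (p≢q ∘ sym))) deg≡0
  ... | inj₁ (pre , post , c , a , refl , a∼pc)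
    with orient k ((c , q) ∷ pre ++ post) (subst (_≤ k) (↭.↭-length (↭.shift a pre post)) len)
                (even-merge {q = q} pre post a∼pc even)
  ... | g ∷ R , g∼cq ∷ R∼ , bal with pointwise-++⁻ pre R∼
  ... | pre′ , post′ , refl , pre∼ , post∼ with split-orientation pre′ post′ a∼pc g∼cq bal
  ... | b₁ , b₂ , b₁∼pq , a∼b₂ , bal′ =
    b₁ ∷ pre′ ++ b₂ ∷ post′ , b₁∼pq ∷ Pointwise.++⁺ pre∼ (a∼b₂ ∷ post∼) , bal′

  euler-orientation : ∀ L → EvenDegrees L → ∃ λ L′ → Pointwise Reorients L L′ × Balanced L′
  euler-orientation L = orient (List.length L) L ℕ.≤-refl

  euler-orientation-family : ∀ {k} (e : Fin k → Arc) → EvenDegrees (List.tabulate e) →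
    ∃ λ (a : Fin k → Arc) → (∀ i → Reorients (e i) (a i)) ×
      (∀ x → ∑[ i < k ] tail-at x (a i) ≡ ∑[ i < k ] head-at x (a i))
  euler-orientation-family e even with euler-orientation (List.tabulate e) even
  ... | L′ , e∼L′ , balanced with pointwise-tabulate⁻ e∼L′
  ... | a , refl , e∼a = a , e∼a , λ x →
    trans (sym (weight-tabulate (tail-at x) a)) (trans (balanced x) (weight-tabulate (head-at x) a))

-- The construction

𝟙-does-mono : ∀ {P Q : Set} (P? : Dec P) (Q? : Dec Q) → (P → Q) → 𝟙 (does P?) ≤ 𝟙 (does Q?)
𝟙-does-mono (yes _) (yes _) _   = ℕ.≤-refl
𝟙-does-mono (yes p) (no ¬q) P→Q = contradiction (P→Q p) ¬q
𝟙-does-mono (no _)  _       _   = z≤n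

𝟙-does-< : ∀ {P Q : Set} (P? : Dec P) (Q? : Dec Q) → ¬ P → Q → 𝟙 (does P?) < 𝟙 (does Q?)
𝟙-does-< P? Q? ¬p q rewrite dec-false P? ¬p | dec-true Q? q = ℕ.≤-refl

∑-mono-≤ : ∀ {n} {f g : Fin n → ℕ} → (∀ i → f i ≤ g i) → sum f ≤ sum g
∑-mono-≤ {zero}  f≤g = z≤n
∑-mono-≤ {suc n} f≤g = ℕ.+-mono-≤ (f≤g zero) (∑-mono-≤ (f≤g ∘ suc))

∑-mono-< : ∀ {n} {f g : Fin n → ℕ} → (∀ i → f i ≤ g i) → ∀ j → f j < g j → sum f < sum g
∑-mono-< {suc n} f≤g zero    fj<gj = ℕ.+-mono-<-≤ fj<gj (∑-mono-≤ (f≤g ∘ suc))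
∑-mono-< {suc n} f≤g (suc j) fj<gj = ℕ.+-mono-≤-< (f≤g zero) (∑-mono-< (f≤g ∘ suc) j fj<gj)

injective⇒surjective : ∀ {a b} (f : Fin a → Fin b) → a ≡ b → Injective _≡_ _≡_ f → ∀ y → ∃ λ x → f x ≡ y
injective⇒surjective {a} {suc b} f a≡1+b f-inj y with any? (λ x → f x ≟ y)
... | yes hit = hit
... | no miss = contradiction (Fin.injective⇒≤ punched-inj) (subst (_≰ b) (sym a≡1+b) (ℕ.n≮n b))
  where
  f≢y : ∀ x → y ≢ f x
  f≢y x y≡fx = miss (x , sym y≡fx)
  punched-inj : Injective _≡_ _≡_ (λ x → punchOut (f≢y x))
  punched-inj = f-inj ∘ Fin.punchOut-injective (f≢y _) (f≢y _)

injective⇒↔ : ∀ {a b} (f : Fin a → Fin b) → a ≡ b → Injective _≡_ _≡_ f →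
  ∃ λ (σ : Fin a ↔ Fin b) → ∀ x → Inverse.to σ x ≡ f x
injective⇒↔ {a} {b} f a≡b f-inj =
  mk↔ₛ′ f (proj₁ ∘ surj) (proj₂ ∘ surj) (λ x → f-inj (proj₂ (surj (f x)))) , λ _ → refl
  where
  surj : ∀ y → ∃ λ x → f x ≡ y
  surj = injective⇒surjective f a≡b f-inj

-- A labelling with all fibres of size h becomes the block structure of Fin (m * h) once
-- each vertex is sent to (label , rank among the vertices with the same label).
fibres⇒↔ : ∀ {n m} h (f : Fin n → Fin m) → (∀ t → ∑[ v < n ] δ (f v) t ≡ h) →
  ∃ λ (ρ : Fin n ↔ Fin (m * h)) → ∀ v → quotient h (Inverse.to ρ v) ≡ f v
fibres⇒↔ {n} {m} h f fibre≡h = relabel , quotient-relabel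
  where
  Earlier : Fin n → Fin n → Set
  Earlier u v = f u ≡ f v × u <ᶠ v

  earlier? : ∀ u v → Dec (Earlier u v)
  earlier? u v = f u ≟ f v ×-dec u <ᶠ? v

  rank : Fin n → ℕ
  rank v = ∑[ u < n ] 𝟙 (does (earlier? u v))

  rank<h : ∀ v → rank v < h
  rank<h v = subst (rank v <_) (fibre≡h (f v))
    (∑-mono-< (λ u → 𝟙-does-mono (earlier? u v) (f u ≟ f v) proj₁) v
              (𝟙-does-< (earlier? v v) (f v ≟ f v) (Fin.<-irrefl refl ∘ proj₂) refl))

  rank-mono : ∀ {v w} → f v ≡ f w → v <ᶠ w → rank v < rank w
  rank-mono {v} {w} fv≡fw v<w =
    ∑-mono-< (λ u → 𝟙-does-mono (earlier? u v) (earlier? u w) λ (fu≡fv , u<v) → trans fu≡fv fv≡fw , Fin.<-trans u<v v<w) v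
             (𝟙-does-< (earlier? v v) (earlier? v w) (Fin.<-irrefl refl ∘ proj₂) (fv≡fw , v<w))

  φ : Fin n → Fin (m * h)
  φ v = combine (f v) (fromℕ< (rank<h v))

  φ-injective : Injective _≡_ _≡_ φ
  φ-injective {v} {w} φv≡φw with Fin.combine-injective (f v) _ (f w) _ φv≡φw
  ... | fv≡fw , ranks≡ = by-order (Fin.<-cmp v w)
    where
    rank≡ : rank v ≡ rank w
    rank≡ = Fin.fromℕ<-injective (rank v) (rank w) (rank<h v) (rank<h w) ranks≡
    by-order : Tri (v <ᶠ w) (v ≡ w) (w <ᶠ v) → v ≡ w
    by-order (tri< v<w _ _) = contradiction rank≡ (ℕ.<⇒≢ (rank-mono fv≡fw v<w))
    by-order (tri≈ _ v≡w _) = v≡w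
    by-order (tri> _ _ w<v) = contradiction (sym rank≡) (ℕ.<⇒≢ (rank-mono (sym fv≡fw) w<v))

  n≡m*h : n ≡ m * h
  n≡m*h = begin
    n                              ≡⟨ ℕ.*-identityʳ n ⟨
    n * 1                          ≡⟨ ∑-const {n} 1 ⟨
    ∑[ v < n ] 1                   ≡⟨ sum-cong-≗ {n} (λ v → ∑-δˡ (f v)) ⟨
    ∑[ v < n ] ∑[ t < m ] δ (f v) t ≡⟨ ∑-comm (λ v t → δ (f v) t) ⟩
    ∑[ t < m ] ∑[ v < n ] δ (f v) t ≡⟨ sum-cong-≗ {m} fibre≡h ⟩
    ∑[ t < m ] h                   ≡⟨ ∑-const {m} h ⟩
    m * h                          ∎
    where open ≡-Reasoning

  relabel : Fin n ↔ Fin (m * h)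
  relabel = proj₁ (injective⇒↔ φ n≡m*h φ-injective)

  quotient-relabel : ∀ v → quotient h (Inverse.to relabel v) ≡ f v
  quotient-relabel v = trans (cong (quotient h) (proj₂ (injective⇒↔ φ n≡m*h φ-injective) v))
                             (cong proj₁ (Fin.remQuot-combine (f v) (fromℕ< (rank<h v))))

n+n-injective : ∀ {a b} → a + a ≡ b + b → a ≡ b
n+n-injective {a} {b} eq = ℕ.*-cancelˡ-≡ a b 2 (trans (double a) (trans eq (sym (double b))))
  where
  double : ∀ x → 2 * x ≡ x + x
  double x = cong (x +_) (ℕ.+-identityʳ x)

lookup-constructed : ∀ {m h} (M : Matching m h) t w →
  lookup (constructed M t) w ≡ does (quotient h w ≟ t) ∨ does (proj₁ (Inverse.to (Matching.match M) w) ≟ t)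
lookup-constructed {m} {h} M t w = begin
  lookup (constructed M t) w                          ≡⟨ Vec.lookup∘tabulate _ w ⟩
  lookup (Vblock m h t) w ∨ lookup (Wset M t) w       ≡⟨ cong₂ _∨_ (Vec.lookup∘tabulate _ w) (Vec.lookup∘tabulate _ w) ⟩
  does (quotient h w ≟ t) ∨ does (proj₁ (Inverse.to (Matching.match M) w) ≟ t) ∎
  where open ≡-Reasoning

-- W t = V s and W s = V t would make the edges e s = V s ∪ W s and e t equal.
injective⇒admissible : ∀ {m h} (M : Matching m h) → Injective _≡_ _≡_ (constructed M) → Admissible M
injective⇒admissible {m} {h} M inj s t s≢t Wt≡Vs Ws≡Vt = s≢t (inj (Vec.tabulate-cong λ w → begin
  lookup (Vblock m h s) w ∨ lookup (Wset M s) w        ≡⟨ cong (λ W → lookup (Vblock m h s) w ∨ lookup W w) Ws≡Vt ⟩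
  lookup (Vblock m h s) w ∨ lookup (Vblock m h t) w    ≡⟨ Bool.∨-comm (lookup (Vblock m h s) w) _ ⟩
  lookup (Vblock m h t) w ∨ lookup (Vblock m h s) w    ≡⟨ cong (λ W → lookup (Vblock m h t) w ∨ lookup W w) Wt≡Vs ⟨
  lookup (Vblock m h t) w ∨ lookup (Wset M t) w        ∎))
  where open ≡-Reasoning

lookup-ext : ∀ {n} {p q : Subset n} → (∀ i → lookup p i ≡ lookup q i) → p ≡ q
lookup-ext {p = p} {q} p≗q = trans (sym (Vec.tabulate∘lookup p)) (trans (Vec.tabulate-cong p≗q) (Vec.tabulate∘lookup q))

module Construction {n m} h (E : Fin m → Subset n) (reg : Regular 2 E) (uniform : Uniform (h + h) E) where
  open TwoRegular E reg
  open Orientation m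

  ends : Fin n → Arc
  ends v = edge₁ v , edge₂ v

  even : EvenDegrees (List.tabulate ends)
  even x = begin
    parity (deg x (List.tabulate ends))                   ≡⟨ cong parity (weight-tabulate (ends-at x) ends) ⟩
    parity (∑[ v < n ] (δ (edge₁ v) x + δ (edge₂ v) x))  ≡⟨ cong parity (trans (∑-ends≡∣E∣ x) (uniform x)) ⟩
    parity (h + h)                                       ≡⟨ parity-n+n h ⟩
    0ℙ                                                   ∎
    where open ≡-Reasoning

  oriented : ∃ λ (a : Fin n → Arc) → (∀ v → Reorients (ends v) (a v)) ×
               (∀ x → ∑[ v < n ] tail-at x (a v) ≡ ∑[ v < n ] head-at x (a v))
  oriented = euler-orientation-family ends even

  tail head : Fin n → Fin m
  tail = proj₁ ∘ proj₁ oriented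
  head = proj₂ ∘ proj₁ oriented

  ends-reoriented : ∀ v → Reorients (ends v) (tail v , head v)
  ends-reoriented = proj₁ (proj₂ oriented)

  tails+heads : ∀ x → ∑[ v < n ] δ (tail v) x + ∑[ v < n ] δ (head v) x ≡ h + h
  tails+heads x = begin
    ∑[ v < n ] δ (tail v) x + ∑[ v < n ] δ (head v) x ≡⟨ ∑-distrib-+ (λ v → δ (tail v) x) (λ v → δ (head v) x) ⟨
    ∑[ v < n ] (δ (tail v) x + δ (head v) x)         ≡⟨ sum-cong-≗ {n} (λ v → ends-reorient (ends-reoriented v)) ⟩
    ∑[ v < n ] (δ (edge₁ v) x + δ (edge₂ v) x)       ≡⟨ ∑-ends≡∣E∣ x ⟩
    ∣ E x ∣                                          ≡⟨ uniform x ⟩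
    h + h                                            ∎
    where open ≡-Reasoning

  tail-fibre : ∀ x → ∑[ v < n ] δ (tail v) x ≡ h
  tail-fibre x = n+n-injective (trans (cong (∑[ v < n ] δ (tail v) x +_) (proj₂ (proj₂ oriented) x)) (tails+heads x))

  head-fibre : ∀ x → ∑[ v < n ] δ (head v) x ≡ h
  head-fibre x = trans (sym (proj₂ (proj₂ oriented) x)) (tail-fibre x)

  ρ : Fin n ↔ Fin (m * h)
  ρ = proj₁ (fibres⇒↔ h tail tail-fibre)

  quotient-ρ : ∀ v → quotient h (Inverse.to ρ v) ≡ tail v
  quotient-ρ = proj₂ (fibres⇒↔ h tail tail-fibre)

  σ : Fin n ↔ Fin (m * h)
  σ = proj₁ (fibres⇒↔ h head head-fibre)

  quotient-σ : ∀ v → quotient h (Inverse.to σ v) ≡ head v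
  quotient-σ = proj₂ (fibres⇒↔ h head head-fibre)

  matching : Fin (m * h) ↔ (Fin m × Fin h)
  matching = ↔-trans (↔-sym ρ) (↔-trans σ Fin.*↔×)

  matching-ρ : ∀ v → proj₁ (Inverse.to matching (Inverse.to ρ v)) ≡ head v
  matching-ρ v = trans (cong (quotient h ∘ Inverse.to σ) (Inverse.strictlyInverseʳ ρ v)) (quotient-σ v)

  M : Matching m h
  M = record { match = matching ; avoids = avoids }
    where
    avoids-ρ : ∀ v → quotient h (Inverse.to ρ v) ≢ proj₁ (Inverse.to matching (Inverse.to ρ v))
    avoids-ρ v eq = reorients-≢ (ends-reoriented v) (edge₁≢edge₂ v) (trans (sym (quotient-ρ v)) (trans eq (matching-ρ v)))
    avoids : ∀ w → quotient h w ≢ proj₁ (Inverse.to matching w)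
    avoids w = subst (λ w → quotient h w ≢ proj₁ (Inverse.to matching w))
      (Inverse.strictlyInverseˡ ρ w) (avoids-ρ (Inverse.from ρ w))

  lookup-constructed-ρ : ∀ v t → lookup (constructed M t) (Inverse.to ρ v) ≡ lookup (E t) v
  lookup-constructed-ρ v t = begin
    lookup (constructed M t) (Inverse.to ρ v)
      ≡⟨ lookup-constructed M t (Inverse.to ρ v) ⟩
    does (quotient h (Inverse.to ρ v) ≟ t) ∨ does (proj₁ (Inverse.to matching (Inverse.to ρ v)) ≟ t)
      ≡⟨ cong₂ (λ a b → does (a ≟ t) ∨ does (b ≟ t)) (quotient-ρ v) (matching-ρ v) ⟩
    does (tail v ≟ t) ∨ does (head v ≟ t)
      ≡⟨ ∨-reorient (ends-reoriented v) t ⟨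
    does (edge₁ v ≟ t) ∨ does (edge₂ v ≟ t)
      ≡⟨ lookup-E v t ⟨
    lookup (E t) v
      ∎
    where open ≡-Reasoning

  isomorphic : Isomorphic E (constructed M)
  isomorphic = ρ , ↔-refl , λ v t → mk⇔
    (λ v∈Et → Vec.lookup⇒[]= _ _ (trans (lookup-constructed-ρ v t) (Vec.[]=⇒lookup v∈Et)))
    (λ ρv∈ → Vec.lookup⇒[]= _ _ (trans (sym (lookup-constructed-ρ v t)) (Vec.[]=⇒lookup ρv∈)))

  admissible : Injective _≡_ _≡_ E → Admissible M
  admissible E-injective = injective⇒admissible M λ {s} {t} Ms≡Mt → E-injective (lookup-ext λ v →
    trans (sym (lookup-constructed-ρ v s)) (trans (cong (λ p → lookup p (Inverse.to ρ v)) Ms≡Mt) (lookup-constructed-ρ v t)))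

even⇒half+half : ∀ k → Even k → k ≡ k / 2 + k / 2
even⇒half+half k even = begin
  k                   ≡⟨ DivMod.m≡m%n+[m/n]*n k 2 ⟩
  k % 2 + k / 2 * 2   ≡⟨ cong (_+ k / 2 * 2) even ⟩
  k / 2 * 2           ≡⟨ ℕ.*-comm (k / 2) 2 ⟩
  k / 2 + (k / 2 + 0) ≡⟨ cong (k / 2 +_) (ℕ.+-identityʳ (k / 2)) ⟩
  k / 2 + k / 2       ∎
  where open ≡-Reasoning

theorem4p6 : ∀ (k n m : ℕ) (E : Fin m → Subset n) →
    4 ≤ k → Even k → Odd m →
    IsHypergraph E → Uniform k E → Regular 2 E →
    MinimalNonOddBipartite E ⇔
      (Connected E ×
        ∃ λ (M : Matching m (k / 2)) → Admissible M × Isomorphic E (constructed M))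
theorem4p6 k n m E _ even-k odd-m (E-injective , nonempty , covered) uniform regular = mk⇔
  (λ minimal → minimalNonOddBipartite⇒connected E covered minimal , M , admissible E-injective , isomorphic)
  (λ (connected , _) → 2-regular⇒¬OddBipartite E odd-m regular
                     , connected⇒oddBipartite-deleteEdge E regular nonempty connected)
  where open Construction (k / 2) E regular (λ t → trans (uniform t) (even⇒half+half k even-k))
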